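{- Let $K_{7,7,7}$ be the complete tripartite graph with vertex set $\{j_i\mid j\in\mathbb{Z}_7,\ i\in\mathbb{Z}_3\}$ and parts $V_i=\{j_i\mid j\in\mathbb{Z}_7\}$, $i\in\mathbb{Z}_3$. For $i,j\in\mathbb{Z}_3$ and $d\in\mathbb{Z}_7$ let $E_{ij}(d)=\{\{l_i,(l+d)_j\}\mid l\in\mathbb{Z}_7\}$. Then the edge set $\bigcup_{d\in\{1,6\}}\left(E_{01}(d)\cup E_{12}(d)\cup E_{20}(d)\right)$ can be partitioned into the edge sets of two $C_7$-factors of $K_{7,7,7}$.
   Context: A $C_7$-factor of a graph $G$ is a spanning subgraph of $G$ each of whose components is a cycle of length 7. -}

module Defs where

open import Data.Nat using (ℕ; _+_)
open import Data.Nat.DivMod using (_mod_)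
open import Data.Fin using (Fin; toℕ; zero; suc)
open import Data.Product using (Σ; _×_; _,_; ∃-syntax; proj₁; proj₂)
open import Data.Sum using (_⊎_)
open import Relation.Binary.PropositionalEquality using (_≡_; _≢_)
open import Function.Definitions using (Injective; Surjective)

ℤ₇ : Set
ℤ₇ = Fin 7

ℤ₃ : Set
ℤ₃ = Fin 3

_+₇_ : ℤ₇ → ℤ₇ → ℤ₇
a +₇ b = (toℕ a + toℕ b) mod 7

-- Vertices of K_{7,7,7}: j_i is the pair (j , i); the part of (j , i) is i.
Vertex : Set
Vertex = ℤ₇ × ℤ₃

part : Vertex → ℤ₃
part (j , i) = i

Adj : Vertex → Vertex → Set
Adj u v = part u ≢ part v

SamePair : Vertex → Vertex → Vertex → Vertex → Set
SamePair u v x y = (u ≡ x × v ≡ y) ⊎ (u ≡ y × v ≡ x)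

E : ℤ₃ → ℤ₃ → ℤ₇ → Vertex → Vertex → Set
E i j d u v = ∃[ l ] SamePair u v (l , i) (l +₇ d , j)

d₁ d₆ : ℤ₇
d₁ = suc zero
d₆ = suc (suc (suc (suc (suc (suc zero)))))

i₀ i₁ i₂ : ℤ₃
i₀ = zero
i₁ = suc zero
i₂ = suc (suc zero)

InS : Vertex → Vertex → Set
InS u v = Σ ℤ₇ λ d → (d ≡ d₁ ⊎ d ≡ d₆) ×
  (E i₀ i₁ d u v ⊎ (E i₁ i₂ d u v ⊎ E i₂ i₀ d u v))

-- Since |V| = 21, it consists of exactly 3 vertex-disjoint 7-cycles covering
-- all vertices. Cycle a is the cyclic sequence cyc a 0, cyc a 1, …, cyc a 6,
-- whose consecutive vertices (cyclically) are adjacent in K_{7,7,7}.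
record C7Factor : Set where
  field
    cyc      : ℤ₃ → ℤ₇ → Vertex
    injective  : Injective _≡_ _≡_ (λ (p : ℤ₃ × ℤ₇) → cyc (proj₁ p) (proj₂ p))
    surjective : Surjective _≡_ _≡_ (λ (p : ℤ₃ × ℤ₇) → cyc (proj₁ p) (proj₂ p))
    adjacent : ∀ a k → Adj (cyc a k) (cyc a (k +₇ d₁))

open C7Factor public

EdgeOf : C7Factor → Vertex → Vertex → Set
EdgeOf F u v = ∃[ a ] ∃[ k ] SamePair u v (cyc F a k) (cyc F a (k +₇ d₁))

-- The edges {l_i , (l ± 1)_j} with i ≠ j are exactly those of the tensor product C₇ × K₃.
-- A proper 3-colouring q of C₇ gives a C₇-factor whose a-th cycle (a ∈ ℤ₃) visits
-- k_(a + q k) for k = 0, …, 6. Between the columns l and l + 1 it uses the edges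
-- {l_i , (l + 1)_(i + δ)} with δ = q (l + 1) − q l ≠ 0, and the factor of −q uses −δ instead.
-- Since δ and −δ are the two nonzero elements of ℤ₃, the factors of q and −q partition C₇ × K₃.

module Submission where

open import Defs
open import Data.Empty using (⊥)
open import Data.Fin using (zero; suc; toℕ; #_)
open import Data.Fin.Properties using (_≟_; all?; any?)
open import Data.Nat using (_+_)
open import Data.Nat.DivMod using (_mod_)
open import Data.Product using (Σ; ∃; _×_; _,_; proj₁; proj₂; swap; map₂)
open import Data.Sum using (_⊎_; inj₁; inj₂; [_,_])
import Data.Sum as Sum
open import Data.Vec using (lookup; _∷_; [])
open import Function using (_∘_)
open import Function.Bundles using (_⇔_; mk⇔)
open import Relation.Binary.Definitions using (Symmetric)
open import Relation.Binary.PropositionalEquality using (_≡_; _≢_; refl; sym; trans; cong; subst)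
open import Relation.Nullary using (¬_; contradiction)
open import Relation.Nullary.Decidable using (from-yes; _×-dec_; _⊎-dec_; _→-dec_; ¬?)

_+₃_ : ℤ₃ → ℤ₃ → ℤ₃
a +₃ b = (toℕ a + toℕ b) mod 3

-₃_ : ℤ₃ → ℤ₃
-₃ zero = zero
-₃ suc zero = suc (suc zero)
-₃ suc (suc zero) = suc zero

+₃-cancelʳ : ∀ a b x → a +₃ x ≡ b +₃ x → a ≡ b
+₃-cancelʳ = from-yes (all? λ a → all? λ b → all? λ x → (a +₃ x ≟ b +₃ x) →-dec (a ≟ b))

+₃-cancelˡ : ∀ x a b → x +₃ a ≡ x +₃ b → a ≡ b
+₃-cancelˡ = from-yes (all? λ x → all? λ a → all? λ b → (x +₃ a ≟ x +₃ b) →-dec (a ≟ b))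

[i-x]+x≡i : ∀ i x → (i +₃ (-₃ x)) +₃ x ≡ i
[i-x]+x≡i = from-yes (all? λ i → all? λ x → (i +₃ (-₃ x)) +₃ x ≟ i)

-₃-injective : ∀ x y → -₃ x ≡ -₃ y → x ≡ y
-₃-injective = from-yes (all? λ x → all? λ y → (-₃ x ≟ -₃ y) →-dec (x ≟ y))

translates-cover : ∀ x y i j → x ≢ y → i ≢ j →
  (∃ λ a → a +₃ x ≡ i × a +₃ y ≡ j) ⊎ (∃ λ a → a +₃ (-₃ x) ≡ i × a +₃ (-₃ y) ≡ j)
translates-cover = from-yes (all? λ x → all? λ y → all? λ i → all? λ j →
  ¬? (x ≟ y) →-dec (¬? (i ≟ j) →-dec
    (any? (λ a → (a +₃ x ≟ i) ×-dec (a +₃ y ≟ j)) ⊎-dec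
     any? (λ a → (a +₃ (-₃ x) ≟ i) ×-dec (a +₃ (-₃ y) ≟ j)))))

translates-disjoint : ∀ x y a b → a +₃ x ≡ b +₃ (-₃ x) → a +₃ y ≡ b +₃ (-₃ y) → x ≡ y
translates-disjoint = from-yes (all? λ x → all? λ y → all? λ a → all? λ b →
  (a +₃ x ≟ b +₃ (-₃ x)) →-dec ((a +₃ y ≟ b +₃ (-₃ y)) →-dec (x ≟ y)))

[l+1]+6≡l : ∀ l → (l +₇ d₁) +₇ d₆ ≡ l
[l+1]+6≡l = from-yes (all? λ l → (l +₇ d₁) +₇ d₆ ≟ l)

[l+6]+1≡l : ∀ l → (l +₇ d₆) +₇ d₁ ≡ l
[l+6]+1≡l = from-yes (all? λ l → (l +₇ d₆) +₇ d₁ ≟ l)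

[l+1]+1≢l : ∀ l → (l +₇ d₁) +₇ d₁ ≢ l
[l+1]+1≢l = from-yes (all? λ l → ¬? ((l +₇ d₁) +₇ d₁ ≟ l))

SamePair-sym : ∀ {u v x y} → SamePair u v x y → SamePair v u x y
SamePair-sym = Sum.swap ∘ Sum.map swap swap

SamePair-elim : ∀ {R : Vertex → Vertex → Set} → Symmetric R →
  ∀ {u v x y} → SamePair u v x y → R x y → R u v
SamePair-elim R-sym (inj₁ (refl , refl)) r = r
SamePair-elim R-sym (inj₂ (refl , refl)) r = R-sym r

EdgeOf-sym : ∀ F → Symmetric (EdgeOf F)
EdgeOf-sym F = map₂ (map₂ SamePair-sym)

EdgeOf-elim : ∀ {R : Vertex → Vertex → Set} → Symmetric R → ∀ F →
  (∀ a k → R (cyc F a k) (cyc F a (k +₇ d₁))) → ∀ {u v} → EdgeOf F u v → R u v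
EdgeOf-elim R-sym F edge (a , k , sp) = SamePair-elim R-sym sp (edge a k)

InS-sym : Symmetric InS
InS-sym = map₂ (map₂ (Sum.map E-sym (Sum.map E-sym E-sym)))
  where
  E-sym : ∀ {i j d} → Symmetric (E i j d)
  E-sym = map₂ SamePair-sym

InS-step : ∀ l {i j} → i ≢ j → InS (l , i) (l +₇ d₁ , j)
InS-step l {zero} {zero} i≢j = contradiction refl i≢j
InS-step l {zero} {suc zero} _ = d₁ , inj₁ refl , inj₁ (l , inj₁ (refl , refl))
InS-step l {zero} {suc (suc zero)} _ =
  d₆ , inj₂ refl , inj₂ (inj₂ (l +₇ d₁ , inj₂ (cong (_, i₀) (sym ([l+1]+6≡l l)) , refl)))
InS-step l {suc zero} {zero} _ =
  d₆ , inj₂ refl , inj₁ (l +₇ d₁ , inj₂ (cong (_, i₁) (sym ([l+1]+6≡l l)) , refl))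
InS-step l {suc zero} {suc zero} i≢j = contradiction refl i≢j
InS-step l {suc zero} {suc (suc zero)} _ = d₁ , inj₁ refl , inj₂ (inj₁ (l , inj₁ (refl , refl)))
InS-step l {suc (suc zero)} {zero} _ = d₁ , inj₁ refl , inj₂ (inj₂ (l , inj₁ (refl , refl)))
InS-step l {suc (suc zero)} {suc zero} _ =
  d₆ , inj₂ refl , inj₂ (inj₁ (l +₇ d₁ , inj₂ (cong (_, i₂) (sym ([l+1]+6≡l l)) , refl)))
InS-step l {suc (suc zero)} {suc (suc zero)} i≢j = contradiction refl i≢j

InS-elim : ∀ {R : Vertex → Vertex → Set} → Symmetric R →
  (∀ l {i j} → i ≢ j → R (l , i) (l +₇ d₁ , j)) → ∀ {u v} → InS u v → R u v
InS-elim {R} R-sym step (d , d∈ , e) = [ E⇒ (λ ()) , [ E⇒ (λ ()) , E⇒ (λ ()) ] ] e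
  where
  generator : ∀ {d i j} → d ≡ d₁ ⊎ d ≡ d₆ → i ≢ j → ∀ l → R (l , i) (l +₇ d , j)
  generator (inj₁ refl) i≢j l = step l i≢j
  -- {l_i , (l + 6)_j} is the step from (l + 6)_j to l_i, read backwards.
  generator (inj₂ refl) i≢j l =
    R-sym (subst (λ m → R (l +₇ d₆ , _) (m , _)) ([l+6]+1≡l l) (step (l +₇ d₆) (i≢j ∘ sym)))

  E⇒ : ∀ {i j u v} → i ≢ j → E i j d u v → R u v
  E⇒ i≢j (l , sp) = SamePair-elim R-sym sp (generator d∈ i≢j l)

ProperColouring : (ℤ₇ → ℤ₃) → Set
ProperColouring q = ∀ k → q k ≢ q (k +₇ d₁)

-₃-proper : ∀ {q} → ProperColouring q → ProperColouring (-₃_ ∘ q)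
-₃-proper proper k = proper k ∘ -₃-injective _ _

colouringFactor : ∀ q → ProperColouring q → C7Factor
colouringFactor q proper = record
  { cyc = λ a k → k , a +₃ q k
  ; injective = cyc-injective
  ; surjective = λ (j , i) → (i +₃ (-₃ q j) , j) , λ { refl → cong (j ,_) ([i-x]+x≡i i (q j)) }
  ; adjacent = λ a k → proper k ∘ +₃-cancelˡ a _ _
  }
  where
  cyc-injective : ∀ {x y} → (proj₂ x , proj₁ x +₃ q (proj₂ x)) ≡ (proj₂ y , proj₁ y +₃ q (proj₂ y)) →
           x ≡ y
  cyc-injective {a , k} {b , m} eq with cong proj₁ eq
  ... | refl = cong (_, k) (+₃-cancelʳ a b (q k) (cong proj₂ eq))

colouringFactor-edge : ∀ q proper a {l i j} → a +₃ q l ≡ i → a +₃ q (l +₇ d₁) ≡ j →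
  EdgeOf (colouringFactor q proper) (l , i) (l +₇ d₁ , j)
colouringFactor-edge q proper a {l} refl refl = a , l , inj₁ (refl , refl)

colouringFactor-edge⇒InS : ∀ q proper {u v} → EdgeOf (colouringFactor q proper) u v → InS u v
colouringFactor-edge⇒InS q proper = EdgeOf-elim InS-sym F (λ a k → InS-step k (adjacent F a k))
  where F = colouringFactor q proper

module OppositeFactors (q : ℤ₇ → ℤ₃) (proper : ProperColouring q) where

  F₊ F₋ : C7Factor
  F₊ = colouringFactor q proper
  F₋ = colouringFactor (-₃_ ∘ q) (-₃-proper proper)

  InS⇒F₊⊎F₋ : ∀ {u v} → InS u v → EdgeOf F₊ u v ⊎ EdgeOf F₋ u v
  InS⇒F₊⊎F₋ = InS-elim (Sum.map (EdgeOf-sym F₊) (EdgeOf-sym F₋)) step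
    where
    step : ∀ l {i j} → i ≢ j → EdgeOf F₊ (l , i) (l +₇ d₁ , j) ⊎ EdgeOf F₋ (l , i) (l +₇ d₁ , j)
    step l i≢j = Sum.map (λ (a , p , p′) → colouringFactor-edge q proper a p p′)
                         (λ (a , p , p′) → colouringFactor-edge (-₃_ ∘ q) (-₃-proper proper) a p p′)
                         (translates-cover (q l) (q (l +₇ d₁)) _ _ (proper l) i≢j)

  F₊⊎F₋⇒InS : ∀ {u v} → EdgeOf F₊ u v ⊎ EdgeOf F₋ u v → InS u v
  F₊⊎F₋⇒InS = [ colouringFactor-edge⇒InS q proper
              , colouringFactor-edge⇒InS (-₃_ ∘ q) (-₃-proper proper) ]

  F₊-F₋-disjoint : ∀ {u v} → EdgeOf F₊ u v → ¬ EdgeOf F₋ u v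
  F₊-F₋-disjoint = EdgeOf-elim (λ ¬e → ¬e ∘ EdgeOf-sym F₋) F₊ not-in-F₋
    where
    not-in-F₋ : ∀ a k → ¬ EdgeOf F₋ (k , a +₃ q k) (k +₇ d₁ , a +₃ q (k +₇ d₁))
    not-in-F₋ a k (b , m , inj₁ (e , e′)) with cong proj₁ e
    ... | refl = proper k (translates-disjoint (q k) (q (k +₇ d₁)) a b (cong proj₂ e) (cong proj₂ e′))
    not-in-F₋ a k (b , m , inj₂ (e , e′)) =
      [l+1]+1≢l m (trans (cong (_+₇ d₁) (sym (cong proj₁ e))) (cong proj₁ e′))

colouring : ℤ₇ → ℤ₃
colouring = lookup (# 0 ∷ # 1 ∷ # 2 ∷ # 0 ∷ # 1 ∷ # 2 ∷ # 1 ∷ [])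

colouring-proper : ProperColouring colouring
colouring-proper = from-yes (all? λ k → ¬? (colouring k ≟ colouring (k +₇ d₁)))

lemma2p3 : Σ C7Factor λ F₁ → Σ C7Factor λ F₂ →
    (∀ u v → InS u v ⇔ (EdgeOf F₁ u v ⊎ EdgeOf F₂ u v)) ×
    (∀ u v → EdgeOf F₁ u v → EdgeOf F₂ u v → ⊥)
lemma2p3 = F₊ , F₋ , (λ _ _ → mk⇔ InS⇒F₊⊎F₋ F₊⊎F₋⇒InS) , (λ _ _ → F₊-F₋-disjoint)
  where open OppositeFactors colouring colouring-proper
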